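{- For the elementary cellular automaton $F_{44}$ and every nonempty finite word $u\in\{0,1\}^*$, $D(\textsc{SInv}_{F_{44},u,n})\in O(1)$ as $n\to\infty$.
   Context: The ECA with Wolfram number $N$ is $F_N:\{0,1\}^{\mathbb{Z}}\to\{0,1\}^{\mathbb{Z}}$, $(F_N(x))_i=f_N(x_{i-1},x_i,x_{i+1})$, where $f_N(a,b,c)$ is the bit of index $4a+2b+c$ of $N$ in binary. For a nonempty word $u$, $p_u\in\{0,1\}^{\mathbb{Z}}$ is $(p_u)_i=u_{i\bmod |u|}$; for a finite word $x$, $p_u[x]$ equals $x$ on positions $\{0,\dots,|x|-1\}$ and $p_u$ elsewhere. $\textsc{SInv}_{F,u,n}:\{0,1\}^n\to\{0,1\}$ maps $x$ to $1$ iff there is an integer $w$ such that for every $t\ge 0$ the set of positions where $F^t(p_u)$ and $F^t(p_u[x])$ differ is contained in an interval of length $w$. For finite sets $X,Y,Z$ and $g:X\times Y\to Z$, $D(g)$ is the minimal depth of a deterministic two-party communication protocol tree computing $g$ (Alice knows $x$, Bob knows $y$; internal nodes are labelled by a function of $x$ alone or of $y$ alone to $\{\mathrm{l},\mathrm{r}\}$, leaves by outputs). For $g:\{0,1\}^m\to Z$, $D(g)=\max_{0\le i\le m} D(g_i)$ with $g_i(x,y)=g(xy)$ for $x\in\{0,1\}^i$, $y\in\{0,1\}^{m-i}$. -}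

module Defs where

open import Data.Bool using (Bool; true; false; if_then_else_)
open import Data.Nat as ℕ using (ℕ; zero; suc; _≡ᵇ_)
import Data.Nat.DivMod as ℕD
open import Data.Nat.Properties using (_<?_)
open import Data.Integer as ℤ using (ℤ; +_; -[1+_]; _%ℕ_)
open import Data.Integer.DivMod using (n%ℕd<d)
open import Data.Fin using (Fin; fromℕ<)
open import Data.Vec using (Vec; lookup; _++_)
open import Data.Product using (Σ; ∃; _×_; _,_)
open import Function using (_⇔_)
open import Relation.Nullary using (¬_; yes; no)
open import Relation.Binary.PropositionalEquality using (_≡_)

-- Configurations of {0,1}^ℤ (bits as Bool: false = 0, true = 1)
Config : Set
Config = ℤ → Bool

bitval : Bool → ℕ
bitval false = 0
bitval true  = 1

testBit : ℕ → ℕ → Bool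
testBit N zero    = (N ℕD.% 2) ≡ᵇ 1
testBit N (suc k) = testBit (N ℕD./ 2) k

localRule : ℕ → Bool → Bool → Bool → Bool
localRule N a b c = testBit N (4 ℕ.* bitval a ℕ.+ 2 ℕ.* bitval b ℕ.+ bitval c)

ECA : ℕ → Config → Config
ECA N x i = localRule N (x (i ℤ.- ℤ.1ℤ)) (x i) (x (i ℤ.+ ℤ.1ℤ))

iterate : (Config → Config) → ℕ → Config → Config
iterate F zero    x = x
iterate F (suc t) x = F (iterate F t x)

periodic : ∀ {k} → Vec Bool (suc k) → Config
periodic {k} u i = lookup u (fromℕ< (n%ℕd<d i (suc k)))

patch : ∀ {k n} → Vec Bool (suc k) → Vec Bool n → Config
patch {n = n} u x (+ j) with j <? n
... | yes j<n = lookup x (fromℕ< j<n)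
... | no  _   = periodic u (+ j)
patch u x -[1+ j ] = periodic u -[1+ j ]

SInv : (Config → Config) → ∀ {k} → Vec Bool (suc k) → ∀ n → Vec Bool n → Set
SInv F u n x =
  ∃ λ (w : ℕ) → ∀ (t : ℕ) → ∃ λ (a : ℤ) → ∀ (i : ℤ) →
    ¬ (iterate F t (periodic u) i ≡ iterate F t (patch u x) i) →
    (a ℤ.≤ i) × (i ℤ.< a ℤ.+ + w)

-- Deterministic two-party protocol trees: Alice knows x : X, Bob knows y : Y.
-- Internal node labels are functions to {l,r} (false = l, true = r).
data Protocol (X Y Z : Set) : Set where
  leaf  : Z → Protocol X Y Z
  alice : (X → Bool) → Protocol X Y Z → Protocol X Y Z → Protocol X Y Z
  bob   : (Y → Bool) → Protocol X Y Z → Protocol X Y Z → Protocol X Y Z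

depth : ∀ {X Y Z} → Protocol X Y Z → ℕ
depth (leaf _)      = 0
depth (alice _ l r) = suc (depth l ℕ.⊔ depth r)
depth (bob _ l r)   = suc (depth l ℕ.⊔ depth r)

run : ∀ {X Y Z} → Protocol X Y Z → X → Y → Z
run (leaf z)      x y = z
run (alice f l r) x y = if f x then run r x y else run l x y
run (bob g l r)   x y = if g y then run r x y else run l x y

Computes : ∀ {X Y} → Protocol X Y Bool → (X → Y → Set) → Set
Computes p P = ∀ x y → (run p x y ≡ true) ⇔ P x y

DLe : ∀ {X Y} → (X → Y → Set) → ℕ → Set
DLe {X} {Y} P c = Σ (Protocol X Y Bool) λ p → Computes p P × (depth p ℕ.≤ c)

-- D(g) ≤ c for g : {0,1}^n → {0,1} given by a predicate on Vec Bool n: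
-- every split n = i + m admits a protocol of depth ≤ c for g_i.
DLeSplit : ∀ {n} → (Vec Bool n → Set) → ℕ → Set
DLeSplit {n} P c = ∀ i m → (e : i ℕ.+ m ≡ n) →
  DLe (λ (x : Vec Bool i) (y : Vec Bool m) → P (subst' e (x ++ y))) c
  where
  subst' : ∀ {a b} → a ≡ b → Vec Bool a → Vec Bool b
  subst' Relation.Binary.PropositionalEquality.refl v = v

-- Write P for the periodic background p_u and Y for the patched configuration p_u[x]. Under
-- rule 44 a pair 00 (a wall) is never destroyed and no information crosses it. If F²(P) has a
-- wall, it has walls with period |u|, so for t ≥ 2 all differences between Fᵗ(P) and Fᵗ(Y) are
-- trapped between two fixed walls and SInv is constantly 1. Otherwise a finite check shows that
-- P is a shift of (011)^ℤ, on which F acts as the left shift. Then the rightmost difference of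
-- P and Y moves right at speed 1 forever, while within two steps a wall forms next to where it
-- started, so the differences spread without bound unless Y = P. Hence SInv(x) holds iff x is
-- the segment of P on [0, n), which Alice and Bob test on their halves with two bits.

module Submission where

open import Defs
open import Data.Bool using (Bool; true; false; not)
open import Data.Bool.Properties using (¬-not) renaming (_≟_ to _≟ᴮ_)
open import Data.Nat as ℕ using (ℕ; zero; suc; _≤_; z≤n; s≤s; _≤′_)
import Data.Nat.Properties as ℕ
open import Data.Nat.DivMod using ([m+n]%n≡m%n; m<n⇒m%n≡m; n%n≡0; m≤n⇒[n∸m]%m≡n%m)
open import Data.Integer as ℤ using (ℤ; +_; -[1+_]; _+_; _-_; _*_; -_; _⊖_; ∣_∣; 0ℤ; 1ℤ; -1ℤ; _%ℕ_; _/ℕ_)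
open import Data.Integer.Properties as ℤ using (+-assoc; +-comm; +-identityʳ; ≤-refl; ≤-trans)
open import Data.Integer.DivMod using (n%ℕd<d; a≡a%ℕn+[a/ℕn]*n)
open import Data.Integer.Tactic.RingSolver using (solve-∀)
open import Data.Fin using (Fin; toℕ; fromℕ<; _↑ˡ_; _↑ʳ_; splitAt)
open import Data.Fin.Properties using (toℕ<n; toℕ-fromℕ<; fromℕ<-toℕ; fromℕ<-cong; any?; all?; toℕ-↑ˡ; toℕ-↑ʳ; splitAt⁻¹-↑ˡ; splitAt⁻¹-↑ʳ)
open import Data.Vec using (Vec; []; _∷_; lookup; _++_)
open import Data.Vec.Properties using (lookup-++ˡ; lookup-++ʳ)
open import Data.Product using (∃; ∃₂; _×_; _,_; proj₁; proj₂; uncurry)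
open import Data.Sum using (_⊎_; inj₁; inj₂)
open import Data.Empty using (⊥-elim)
open import Function using (_⇔_; mk⇔; Equivalence; _∘_)
open import Function.Construct.Composition using (_⇔-∘_)
open import Relation.Nullary using (¬_; Dec; yes; no; contradiction)
open import Relation.Nullary.Decidable using (_×-dec_; ¬?; _→-dec_; map′; from-yes; isYes)
open import Relation.Unary using (Decidable)
open import Relation.Binary.PropositionalEquality
open import Relation.Binary.Definitions using (tri<; tri≈; tri>)

i+1-1≡i : ∀ i → i + 1ℤ - 1ℤ ≡ i
i+1-1≡i i = trans (+-assoc i 1ℤ -1ℤ) (+-identityʳ i)

i-1+1≡i : ∀ i → i - 1ℤ + 1ℤ ≡ i
i-1+1≡i i = trans (+-assoc i -1ℤ 1ℤ) (+-identityʳ i)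

i≤i+1 : ∀ i → i ℤ.≤ i + 1ℤ
i≤i+1 i = ℤ.i≤i+j i 1ℤ

i-1≤i : ∀ i → i - 1ℤ ℤ.≤ i
i-1≤i i = ℤ.i-j≤i i 1ℤ

i<j⇒i+1≤j : ∀ {i j} → i ℤ.< j → i + 1ℤ ℤ.≤ j
i<j⇒i+1≤j {i} {j} i<j = subst (ℤ._≤ j) (+-comm 1ℤ i) (ℤ.i<j⇒suc[i]≤j i<j)

i≤∣i∣ : ∀ i → i ℤ.≤ + ∣ i ∣
i≤∣i∣ (+ n) = ≤-refl
i≤∣i∣ -[1+ n ] = ℤ.-≤+

j≤i+∣j-i∣ : ∀ i j → j ℤ.≤ i + + ∣ j - i ∣
j≤i+∣j-i∣ i j = subst (ℤ._≤ i + + ∣ j - i ∣) (i+[j-i]≡j i j) (ℤ.+-monoʳ-≤ i (i≤∣i∣ (j - i)))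
  where
  i+[j-i]≡j : ∀ i j → i + (j - i) ≡ j
  i+[j-i]≡j = solve-∀

-- Periodic configurations

shift : ℤ → Config → Config
shift c y i = y (c + i)

Periodic : ℤ → Config → Set
Periodic c y = shift c y ≗ y

module _ {c : ℤ} {y : Config} (per : Periodic c y) where

  periodic-*ℕ : ∀ m i → y (+ m * c + i) ≡ y i
  periodic-*ℕ zero i = cong y (ℤ.+-identityˡ i)
  periodic-*ℕ (suc m) i = trans (cong y (unfold (+ m) c i)) (trans (per _) (periodic-*ℕ m i))
    where
    unfold : ∀ m c i → (+ 1 + m) * c + i ≡ c + (m * c + i)
    unfold = solve-∀

  periodic-* : ∀ z i → y (z * c + i) ≡ y i
  periodic-* (+ m) = periodic-*ℕ m
  periodic-* -[1+ m ] i = trans (sym (periodic-*ℕ (suc m) _)) (cong y (cancel (+ suc m) c i))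
    where
    cancel : ∀ a c i → a * c + ((- a) * c + i) ≡ i
    cancel = solve-∀

-- The negative case of _%ℕ_ is defined by a with-abstraction on (suc m % d); this is its result.
negResidue : ℕ → ℕ → ℕ
negResidue d zero    = 0
negResidue d (suc r) = d ℕ.∸ suc r

-[1+m]%ℕd : ∀ d .{{_ : ℕ.NonZero d}} m → -[1+ m ] %ℕ d ≡ negResidue d (suc m ℕ.% d)
-[1+m]%ℕd d m with suc m ℕ.% d
... | zero  = refl
... | suc r = refl

[d+i]%ℕd≡i%ℕd : ∀ d .{{_ : ℕ.NonZero d}} i → (+ d + i) %ℕ d ≡ i %ℕ d
[d+i]%ℕd≡i%ℕd d (+ m) = trans (cong (ℕ._% d) (ℕ.+-comm d m)) ([m+n]%n≡m%n m d)
[d+i]%ℕd≡i%ℕd d -[1+ m ] with ℕ.<-cmp (suc m) d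
... | tri< m<d _ _ = begin
  (d ⊖ suc m) %ℕ d               ≡⟨ cong (_%ℕ d) (ℤ.⊖-≥ (ℕ.<⇒≤ m<d)) ⟩
  (d ℕ.∸ suc m) ℕ.% d            ≡⟨ m<n⇒m%n≡m (ℕ.m<n+o⇒m∸n<o d (suc m) (ℕ.m<n+m d (s≤s z≤n))) ⟩
  d ℕ.∸ suc m                    ≡⟨ cong (negResidue d) (sym (m<n⇒m%n≡m m<d)) ⟩
  negResidue d (suc m ℕ.% d)     ≡⟨ sym (-[1+m]%ℕd d m) ⟩
  -[1+ m ] %ℕ d                  ∎
  where open ≡-Reasoning
... | tri≈ _ refl _ = begin
  (d ⊖ d) %ℕ d                   ≡⟨ cong (_%ℕ d) (ℤ.n⊖n≡0 d) ⟩
  0                              ≡⟨ cong (negResidue d) (sym (n%n≡0 d)) ⟩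
  negResidue d (d ℕ.% d)         ≡⟨ sym (-[1+m]%ℕd d m) ⟩
  -[1+ m ] %ℕ d                  ∎
  where open ≡-Reasoning
... | tri> _ _ d<m with suc m ℕ.∸ d in e
...   | zero   = contradiction e (ℕ.m>n⇒m∸n≢0 d<m)
...   | suc m′ = begin
  (d ⊖ suc m) %ℕ d               ≡⟨ cong (_%ℕ d) (ℤ.⊖-< d<m) ⟩
  (- + (suc m ℕ.∸ d)) %ℕ d       ≡⟨ cong (λ j → (- + j) %ℕ d) e ⟩
  -[1+ m′ ] %ℕ d                 ≡⟨ -[1+m]%ℕd d m′ ⟩
  negResidue d (suc m′ ℕ.% d)    ≡⟨ cong (λ j → negResidue d (j ℕ.% d)) (sym e) ⟩
  negResidue d ((suc m ℕ.∸ d) ℕ.% d) ≡⟨ cong (negResidue d) (m≤n⇒[n∸m]%m≡n%m (ℕ.<⇒≤ d<m)) ⟩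
  negResidue d (suc m ℕ.% d)     ≡⟨ sym (-[1+m]%ℕd d m) ⟩
  -[1+ m ] %ℕ d                  ∎
  where open ≡-Reasoning

periodic-isPeriodic : ∀ {k} (u : Vec Bool (suc k)) → Periodic (+ suc k) (periodic u)
periodic-isPeriodic {k} u i = cong (lookup u) (fromℕ<-cong _ _ ([d+i]%ℕd≡i%ℕd (suc k) i) _ _)

-- Light cones of elementary cellular automata

AgreeBelow AgreeFrom : Config → Config → ℤ → Set
AgreeBelow y z c = ∀ {i} → i ℤ.≤ c → y i ≡ z i
AgreeFrom  y z c = ∀ {i} → c ℤ.≤ i → y i ≡ z i

module _ (N : ℕ) where

  ECA-local : ∀ y z i j → y (i - 1ℤ) ≡ z (j - 1ℤ) → y i ≡ z j → y (i + 1ℤ) ≡ z (j + 1ℤ) →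
              ECA N y i ≡ ECA N z j
  ECA-local y z i j l m r =
    trans (cong (λ a → localRule N a (y i) (y (i + 1ℤ))) l) (cong₂ (localRule N (z (j - 1ℤ))) m r)

  ECA-cong : ∀ {y z} → y ≗ z → ECA N y ≗ ECA N z
  ECA-cong {y} {z} y≗z i = ECA-local y z i i (y≗z _) (y≗z i) (y≗z _)

  iterate-cong : ∀ {y z} → y ≗ z → ∀ t → iterate (ECA N) t y ≗ iterate (ECA N) t z
  iterate-cong y≗z zero    = y≗z
  iterate-cong y≗z (suc t) = ECA-cong (iterate-cong y≗z t)

  ECA-shift : ∀ c y → ECA N (shift c y) ≗ shift c (ECA N y)
  ECA-shift c y i =
    ECA-local (shift c y) y i (c + i)
      (cong y (sym (+-assoc c i -1ℤ))) refl (cong y (sym (+-assoc c i 1ℤ)))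

  iterate-shift : ∀ c y t → iterate (ECA N) t (shift c y) ≗ shift c (iterate (ECA N) t y)
  iterate-shift c y zero    i = refl
  iterate-shift c y (suc t) i =
    trans (ECA-cong (iterate-shift c y t) i) (ECA-shift c (iterate (ECA N) t y) i)

  iterate-Periodic : ∀ {c} {y} → Periodic c y → ∀ t → Periodic c (iterate (ECA N) t y)
  iterate-Periodic {c} {y} per t i = trans (sym (iterate-shift c y t i)) (iterate-cong per t i)

  lightCone-below : ∀ {y z c} → AgreeBelow y z c → AgreeBelow (ECA N y) (ECA N z) (c - 1ℤ)
  lightCone-below {y} {z} {c} agree {i} i≤c-1 =
    ECA-local y z i i (agree (≤-trans (i-1≤i i) i≤c)) (agree i≤c) (agree i+1≤c)
    where
    i+1≤c : i + 1ℤ ℤ.≤ c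
    i+1≤c = subst (i + 1ℤ ℤ.≤_) (i-1+1≡i c) (ℤ.+-monoˡ-≤ 1ℤ i≤c-1)
    i≤c : i ℤ.≤ c
    i≤c = ≤-trans (i≤i+1 i) i+1≤c

  lightCone-from : ∀ {y z c} → AgreeFrom y z c → AgreeFrom (ECA N y) (ECA N z) (c + 1ℤ)
  lightCone-from {y} {z} {c} agree {i} c+1≤i =
    ECA-local y z i i (agree c≤i-1) (agree c≤i) (agree (≤-trans c≤i (i≤i+1 i)))
    where
    c≤i-1 : c ℤ.≤ i - 1ℤ
    c≤i-1 = subst (ℤ._≤ i - 1ℤ) (i+1-1≡i c) (ℤ.+-monoˡ-≤ -1ℤ c+1≤i)
    c≤i : c ℤ.≤ i
    c≤i = ≤-trans c≤i-1 (i-1≤i i)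

-- SInv F u n x unfolds to BoundedDifference F (periodic u) (patch u x).
BoundedDifference : (Config → Config) → Config → Config → Set
BoundedDifference G y z = ∃ λ w → ∀ t → ∃ λ a → ∀ i →
  iterate G t y i ≢ iterate G t z i → (a ℤ.≤ i) × (i ℤ.< a + + w)

AgreeBelow-mono : ∀ {y z c c′} → c′ ℤ.≤ c → AgreeBelow y z c → AgreeBelow y z c′
AgreeBelow-mono c′≤c agree i≤c′ = agree (≤-trans i≤c′ c′≤c)

AgreeFrom-mono : ∀ {y z c c′} → c ℤ.≤ c′ → AgreeFrom y z c → AgreeFrom y z c′
AgreeFrom-mono c≤c′ agree c′≤i = agree (≤-trans c≤c′ c′≤i)

confined⇒BoundedDifference : ∀ {G y z} L R →
  (∀ t → AgreeBelow (iterate G t y) (iterate G t z) L × AgreeFrom (iterate G t y) (iterate G t z) R) →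
  BoundedDifference G y z
confined⇒BoundedDifference L R confined =
  ∣ R - (L + 1ℤ) ∣ , λ t → L + 1ℤ , λ i differ →
    i<j⇒i+1≤j (ℤ.≰⇒> (differ ∘ proj₁ (confined t))) ,
    ℤ.<-≤-trans (ℤ.≰⇒> (differ ∘ proj₂ (confined t))) (j≤i+∣j-i∣ (L + 1ℤ) R)

≗⇒BoundedDifference : ∀ N {y z} → y ≗ z → BoundedDifference (ECA N) y z
≗⇒BoundedDifference N y≗z = 0 , λ t → 0ℤ , λ i differ → contradiction (iterate-cong N y≗z t i) differ

-- Walls of rule 44

f : Bool → Bool → Bool → Bool
f = localRule 44

F : Config → Config
F = ECA 44

f-cong : ∀ {a a′ b b′ c c′} → a ≡ a′ → b ≡ b′ → c ≡ c′ → f a b c ≡ f a′ b′ c′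
f-cong refl refl refl = refl

record Wall (y : Config) (i : ℤ) : Set where
  constructor wall
  field
    left  : y i ≡ false
    right : y (i + 1ℤ) ≡ false

open Wall

wall? : ∀ y i → Dec (Wall y i)
wall? y i = map′ (λ (l , r) → wall l r) (λ w → left w , right w)
                 ((y i ≟ᴮ false) ×-dec (y (i + 1ℤ) ≟ᴮ false))

Wall-≗ : ∀ {y z} → y ≗ z → ∀ {i} → Wall y i → Wall z i
Wall-≗ y≗z {i} (wall l r) = wall (trans (sym (y≗z i)) l) (trans (sym (y≗z (i + 1ℤ))) r)

Wall-Periodic : ∀ {c y} → Periodic c y → ∀ {i} → Wall y i → ∀ z → Wall y (z * c + i)
Wall-Periodic {c} {y} per {i} (wall l r) z =
  wall (trans (periodic-* per z i) l)
       (trans (cong y (+-assoc (z * c) i 1ℤ)) (trans (periodic-* per z (i + 1ℤ)) r))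

Wall-residue : ∀ {d} .{{_ : ℕ.NonZero d}} {y} → Periodic (+ d) y → ∀ {j} → Wall y j →
               Wall y (+ (j %ℕ d))
Wall-residue {d} per {j} w = subst (Wall _) residue (Wall-Periodic per w (- (j /ℕ d)))
  where
  cancel : ∀ q d r → - q * d + (r + q * d) ≡ r
  cancel = solve-∀
  residue : - (j /ℕ d) * + d + j ≡ + (j %ℕ d)
  residue = trans (cong (λ i → - (j /ℕ d) * + d + i) (a≡a%ℕn+[a/ℕn]*n j d))
                  (cancel (j /ℕ d) (+ d) (+ (j %ℕ d)))

Wall-shift : ∀ {c y p} → Wall (shift c y) p → Wall y (c + p)
Wall-shift {c} {y} {p} (wall l r) = wall l (trans (cong y (+-assoc c p 1ℤ)) r)

Wall-step : ∀ {y i} → Wall y i → Wall (F y) i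
Wall-step {y} {i} (wall l r) =
  wall (trans (f-cong (refl {x = y (i - 1ℤ)}) l r) (f-?00 (y (i - 1ℤ))))
       (trans (f-cong (trans (cong y (i+1-1≡i i)) l) r (refl {x = y (i + 1ℤ + 1ℤ)}))
              (f-00? (y (i + 1ℤ + 1ℤ))))
  where
  f-?00 : ∀ a → f a false false ≡ false
  f-?00 false = refl
  f-?00 true  = refl
  f-00? : ∀ c → f false false c ≡ false
  f-00? false = refl
  f-00? true  = refl

Wall-persists : ∀ {y i s t} → Wall (iterate F s y) i → s ≤′ t → Wall (iterate F t y) i
Wall-persists w (ℕ.≤′-reflexive refl) = w
Wall-persists w (ℕ.≤′-step s≤′t)      = Wall-step (Wall-persists w s≤′t)

module _ {y z : Config} {W : ℤ} (wy : Wall y W) (wz : Wall z W) where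

  walls-confine-below : AgreeBelow y z (W + 1ℤ) → AgreeBelow (F y) (F z) (W + 1ℤ)
  walls-confine-below agree {i} i≤W+1 with i ℤ.≤? W
  ... | yes i≤W = lightCone-below 44 agree (subst (i ℤ.≤_) (sym (i+1-1≡i W)) i≤W)
  ... | no  i≰W = trans (cong (F y) i≡W+1) (trans (right (Wall-step wy))
                   (sym (trans (cong (F z) i≡W+1) (right (Wall-step wz)))))
    where
    i≡W+1 : i ≡ W + 1ℤ
    i≡W+1 = ℤ.≤-antisym i≤W+1 (i<j⇒i+1≤j (ℤ.≰⇒> i≰W))

  walls-confine-from : AgreeFrom y z W → AgreeFrom (F y) (F z) W
  walls-confine-from agree {i} W≤i with i ℤ.≤? W
  ... | yes i≤W = trans (cong (F y) i≡W) (trans (left (Wall-step wy))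
                   (sym (trans (cong (F z) i≡W) (left (Wall-step wz)))))
    where
    i≡W : i ≡ W
    i≡W = ℤ.≤-antisym i≤W W≤i
  ... | no  i≰W = lightCone-from 44 agree (i<j⇒i+1≤j (ℤ.≰⇒> i≰W))

module _ {k : ℕ} {y : Config} (per : Periodic (+ suc k) y) {i₀ : ℕ} (w : Wall y (+ i₀)) where

  wallBelow : ∀ m → ∃ λ W → W ℤ.≤ - + m × Wall y W
  wallBelow m = W , subst (ℤ._≤ - + m) (sym W≡) (ℤ.i-j≤i (- + m) (+ ((i₀ ℕ.+ m) ℕ.* k))) ,
                Wall-Periodic per w (- (+ i₀ + + m))
    where
    W : ℤ
    W = - (+ i₀ + + m) * + suc k + + i₀
    W≡ : W ≡ - + m - + ((i₀ ℕ.+ m) ℕ.* k)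
    W≡ = trans (expand (+ i₀) (+ m) (+ k)) (cong (λ j → - + m - j) (sym (ℤ.pos-* (i₀ ℕ.+ m) k)))
      where
      expand : ∀ I M K → - (I + M) * (+ 1 + K) + I ≡ - M - (I + M) * K
      expand = solve-∀

  wallFrom : ∀ m → ∃ λ W → + m ℤ.≤ W × Wall y W
  wallFrom m = W , subst (+ m ℤ.≤_) (sym W≡) (ℤ.i≤i+j (+ m) (+ (m ℕ.* k ℕ.+ i₀))) ,
               Wall-Periodic per w (+ m)
    where
    W : ℤ
    W = + m * + suc k + + i₀
    W≡ : W ≡ + m + + (m ℕ.* k ℕ.+ i₀)
    W≡ = trans (expand (+ m) (+ k) (+ i₀)) (cong (λ j → + m + (j + + i₀)) (sym (ℤ.pos-* m k)))
      where
      expand : ∀ M K I → M * (+ 1 + K) + I ≡ M + (M * K + I)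
      expand = solve-∀

module _ {k : ℕ} {y z : Config} (per : Periodic (+ suc k) y) {n : ℕ}
         (agreeBelow : AgreeBelow y z -1ℤ) (agreeFrom : AgreeFrom y z (+ n)) where

  private
    yₜ zₜ : ℕ → Config
    yₜ t = iterate F t y
    zₜ t = iterate F t z

  walls⇒BoundedDifference : ∀ {WL WR} → WL ℤ.≤ -[1+ 3 ] → + (n ℕ.+ 1 ℕ.+ 1) ℤ.≤ WR →
                            Wall (yₜ 2) WL → Wall (yₜ 2) WR → BoundedDifference F y z
  walls⇒BoundedDifference {WL} {WR} WL≤-4 n+2≤WR wallLʸ wallRʸ =
    confined⇒BoundedDifference (WL + 1ℤ) WR confined
    where
    below₁ : AgreeBelow (yₜ 1) (zₜ 1) (-[1+ 1 ])
    below₁ = lightCone-below 44 agreeBelow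
    below₂ : AgreeBelow (yₜ 2) (zₜ 2) (-[1+ 2 ])
    below₂ = lightCone-below 44 below₁
    from₁ : AgreeFrom (yₜ 1) (zₜ 1) (+ (n ℕ.+ 1))
    from₁ = lightCone-from 44 agreeFrom
    from₂ : AgreeFrom (yₜ 2) (zₜ 2) (+ (n ℕ.+ 1 ℕ.+ 1))
    from₂ = lightCone-from 44 from₁
    WL+1≤-3 : WL + 1ℤ ℤ.≤ -[1+ 2 ]
    WL+1≤-3 = ℤ.+-monoˡ-≤ 1ℤ WL≤-4
    wallLᶻ : Wall (zₜ 2) WL
    wallLᶻ = wall (trans (sym (below₂ (≤-trans (i≤i+1 WL) WL+1≤-3))) (left wallLʸ))
                  (trans (sym (below₂ WL+1≤-3)) (right wallLʸ))
    wallRᶻ : Wall (zₜ 2) WR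
    wallRᶻ = wall (trans (sym (from₂ n+2≤WR)) (left wallRʸ))
                  (trans (sym (from₂ (≤-trans n+2≤WR (i≤i+1 WR)))) (right wallRʸ))
    confinedFrom2 : ∀ {t} → 2 ≤′ t → AgreeBelow (yₜ t) (zₜ t) (WL + 1ℤ) × AgreeFrom (yₜ t) (zₜ t) WR
    confinedFrom2 (ℕ.≤′-reflexive refl) = AgreeBelow-mono WL+1≤-3 below₂ , AgreeFrom-mono n+2≤WR from₂
    confinedFrom2 (ℕ.≤′-step 2≤′t) =
      walls-confine-below (Wall-persists wallLʸ 2≤′t) (Wall-persists wallLᶻ 2≤′t)
        (proj₁ (confinedFrom2 2≤′t)) ,
      walls-confine-from (Wall-persists wallRʸ 2≤′t) (Wall-persists wallRᶻ 2≤′t)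
        (proj₂ (confinedFrom2 2≤′t))
    confined : ∀ t → AgreeBelow (yₜ t) (zₜ t) (WL + 1ℤ) × AgreeFrom (yₜ t) (zₜ t) WR
    confined zero =
      AgreeBelow-mono (≤-trans WL+1≤-3 (ℤ.-≤- z≤n)) agreeBelow ,
      AgreeFrom-mono (≤-trans (ℤ.+≤+ (ℕ.≤-trans (ℕ.m≤m+n n 1) (ℕ.m≤m+n (n ℕ.+ 1) 1))) n+2≤WR) agreeFrom
    confined (suc zero) = AgreeBelow-mono (≤-trans WL+1≤-3 (ℤ.-≤- (s≤s z≤n))) below₁ ,
                          AgreeFrom-mono (≤-trans (ℤ.+≤+ (ℕ.m≤m+n (n ℕ.+ 1) 1)) n+2≤WR) from₁
    confined (suc (suc t)) = confinedFrom2 {suc (suc t)} (ℕ.≤⇒≤′ (s≤s (s≤s z≤n)))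

  wall⇒BoundedDifference : ∀ {i₀} → Wall (yₜ 2) (+ i₀) → BoundedDifference F y z
  wall⇒BoundedDifference w
    with wallBelow per₂ w 4 | wallFrom per₂ w (n ℕ.+ 1 ℕ.+ 1)
    where
    per₂ : Periodic (+ suc k) (yₜ 2)
    per₂ = iterate-Periodic 44 {+ suc k} {y} per 2
  ... | _ , WL≤-4 , wallL | _ , n+2≤WR , wallR = walls⇒BoundedDifference WL≤-4 n+2≤WR wallL wallR

-- Streams of rule 44

-- The three neighbourhoods read by rule 44 inside the spatially 3-periodic pattern (011)^ℤ.
data StreamTriple : Bool → Bool → Bool → Set where
  t011 : StreamTriple false true  true
  t110 : StreamTriple true  true  false
  t101 : StreamTriple true  false true

streamTriple? : ∀ a b c → Dec (StreamTriple a b c)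
streamTriple? false true  true  = yes t011
streamTriple? true  true  false = yes t110
streamTriple? true  false true  = yes t101
streamTriple? false false _     = no λ ()
streamTriple? false true  false = no λ ()
streamTriple? true  false false = no λ ()
streamTriple? true  true  true  = no λ ()

StreamTriple-cong : ∀ {a a′ b b′ c c′} → a ≡ a′ → b ≡ b′ → c ≡ c′ →
                    StreamTriple a b c → StreamTriple a′ b′ c′
StreamTriple-cong refl refl refl t = t

f-streamTriple : ∀ {a b c} → StreamTriple a b c → f a b c ≡ c
f-streamTriple t011 = refl
f-streamTriple t110 = refl
f-streamTriple t101 = refl

f-streamTriple-sensitive : ∀ {a b c} → StreamTriple a b c → f a b c ≢ f (not a) b c
f-streamTriple-sensitive t011 ()
f-streamTriple-sensitive t110 ()
f-streamTriple-sensitive t101 ()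

streamTriple-period : ∀ {a b c d} → StreamTriple a b c → StreamTriple b c d → d ≡ a
streamTriple-period t011 t110 = refl
streamTriple-period t110 t101 = refl
streamTriple-period t101 t011 = refl

streamTriple-¬00 : ∀ {a b c} → StreamTriple a b c → ¬ (b ≡ false × c ≡ false)
streamTriple-¬00 t011 (() , _)
streamTriple-¬00 t110 (() , _)
streamTriple-¬00 t101 (_ , ())

Stream : Config → Set
Stream y = ∀ i → StreamTriple (y (i - 1ℤ)) (y i) (y (i + 1ℤ))

Stream-shift : ∀ {y} c → Stream y → Stream (shift c y)
Stream-shift {y} c s i =
  StreamTriple-cong (cong y (+-assoc c i -1ℤ)) refl (cong y (+-assoc c i 1ℤ)) (s (c + i))

F-Stream : ∀ {y} → Stream y → ∀ i → F y i ≡ y (i + 1ℤ)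
F-Stream s i = f-streamTriple (s i)

Stream-F : ∀ {y} → Stream y → Stream (F y)
Stream-F {y} s i = StreamTriple-cong
  (sym (trans (F-Stream s (i - 1ℤ)) (trans (cong y (i-1+1≡i i)) (sym (cong y (i+1-1≡i i))))))
  (sym (F-Stream s i)) (sym (F-Stream s (i + 1ℤ))) (s (i + 1ℤ))

Stream-iterate : ∀ {y} → Stream y → ∀ t → Stream (iterate F t y)
Stream-iterate s zero    = s
Stream-iterate s (suc t) = Stream-F (Stream-iterate s t)

∀-Vec? : ∀ n {P : Vec Bool n → Set} → Decidable P → Dec (∀ v → P v)
∀-Vec? zero    P? = map′ (λ p → λ { [] → p }) (λ ∀P → ∀P []) (P? [])
∀-Vec? (suc n) P? =
  map′ (λ (∀P₁ , ∀P₀) → λ { (true ∷ v) → ∀P₁ v ; (false ∷ v) → ∀P₀ v })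
       (λ ∀P → (λ v → ∀P (true ∷ v)) , (λ v → ∀P (false ∷ v)))
       (∀-Vec? n (P? ∘ (true ∷_)) ×-dec ∀-Vec? n (P? ∘ (false ∷_)))

f² : Bool → Bool → Bool → Bool → Bool → Bool
f² a b c d e = f (f a b c) (f b c d) (f c d e)

NoWalls⇒StreamTriple : Vec Bool 8 → Set
NoWalls⇒StreamTriple (b₀ ∷ b₁ ∷ b₂ ∷ b₃ ∷ b₄ ∷ b₅ ∷ b₆ ∷ b₇ ∷ []) =
  ¬ (f² b₀ b₁ b₂ b₃ b₄ ≡ false × f² b₁ b₂ b₃ b₄ b₅ ≡ false) →
  ¬ (f² b₁ b₂ b₃ b₄ b₅ ≡ false × f² b₂ b₃ b₄ b₅ b₆ ≡ false) →
  ¬ (f² b₂ b₃ b₄ b₅ b₆ ≡ false × f² b₃ b₄ b₅ b₆ b₇ ≡ false) →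
  StreamTriple b₃ b₄ b₅

noWalls⇒streamTriple? : Decidable NoWalls⇒StreamTriple
noWalls⇒streamTriple? (b₀ ∷ b₁ ∷ b₂ ∷ b₃ ∷ b₄ ∷ b₅ ∷ b₆ ∷ b₇ ∷ []) =
  ¬? (wall² b₀ b₁ b₂ b₃ b₄ b₅) →-dec ¬? (wall² b₁ b₂ b₃ b₄ b₅ b₆) →-dec
  ¬? (wall² b₂ b₃ b₄ b₅ b₆ b₇) →-dec streamTriple? b₃ b₄ b₅
  where
  wall² : ∀ a b c d e g → Dec (f² a b c d e ≡ false × f² b c d e g ≡ false)
  wall² a b c d e g = (f² a b c d e ≟ᴮ false) ×-dec (f² b c d e g ≟ᴮ false)

-- Checked by evaluation on all 2⁸ windows.
noWalls⇒streamTriple : ∀ z → ¬ Wall (F (F z)) (-[1+ 1 ]) → ¬ Wall (F (F z)) -1ℤ →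
                       ¬ Wall (F (F z)) 0ℤ → StreamTriple (z -1ℤ) (z 0ℤ) (z 1ℤ)
noWalls⇒streamTriple z ¬w₋₂ ¬w₋₁ ¬w₀ =
  from-yes (∀-Vec? 8 noWalls⇒streamTriple?)
    (z (-[1+ 3 ]) ∷ z (-[1+ 2 ]) ∷ z (-[1+ 1 ]) ∷ z -1ℤ ∷ z 0ℤ ∷ z 1ℤ ∷ z (+ 2) ∷ z (+ 3) ∷ [])
    (¬w₋₂ ∘ uncurry wall) (¬w₋₁ ∘ uncurry wall) (¬w₀ ∘ uncurry wall)

wallForms : ∀ {a b c} → StreamTriple a b c → ∀ z →
            z 0ℤ ≡ not a → z 1ℤ ≡ b → z (+ 2) ≡ c → z (+ 3) ≡ a → z (+ 4) ≡ b → z (+ 5) ≡ c →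
            Wall z 0ℤ ⊎ Wall (F z) 1ℤ ⊎ Wall (F (F z)) (+ 2)
wallForms t011 z e₀ e₁ e₂ e₃ e₄ e₅ = inj₂ (inj₁ (wall (f-cong e₀ e₁ e₂) (f-cong e₁ e₂ e₃)))
wallForms t110 z e₀ e₁ e₂ e₃ e₄ e₅ = inj₂ (inj₂ (wall
  (f-cong (f-cong e₀ e₁ e₂) (f-cong e₁ e₂ e₃) (f-cong e₂ e₃ e₄))
  (f-cong (f-cong e₁ e₂ e₃) (f-cong e₂ e₃ e₄) (f-cong e₃ e₄ e₅))))
wallForms t101 z e₀ e₁ e₂ e₃ e₄ e₅ = inj₁ (wall e₀ e₁)

frontAdvances : ∀ {s z q} → Stream s → s q ≢ z q → AgreeFrom s z (q + 1ℤ) →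
                F s (q + 1ℤ) ≢ F z (q + 1ℤ)
frontAdvances {s} {z} {q} stream sq≢zq agree Fs≡Fz =
  f-streamTriple-sensitive (stream (q + 1ℤ)) (trans Fs≡Fz (f-cong zq′≡¬sq′ zq+1≡sq+1 zq+2≡sq+2))
  where
  zq′≡¬sq′ : z (q + 1ℤ - 1ℤ) ≡ not (s (q + 1ℤ - 1ℤ))
  zq′≡¬sq′ = trans (cong z (i+1-1≡i q))
               (trans (¬-not (sq≢zq ∘ sym)) (cong (not ∘ s) (sym (i+1-1≡i q))))
  zq+1≡sq+1 : z (q + 1ℤ) ≡ s (q + 1ℤ)
  zq+1≡sq+1 = sym (agree ≤-refl)
  zq+2≡sq+2 : z (q + 1ℤ + 1ℤ) ≡ s (q + 1ℤ + 1ℤ)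
  zq+2≡sq+2 = sym (agree (i≤i+1 (q + 1ℤ)))

-- Coordinates are translated so that the rightmost difference sits at 0; the cells around it
-- are then numerals and the local computations below hold by evaluation.
module RightmostDifference {s z : Config} (stream : Stream s)
                           (s₀≢z₀ : s 0ℤ ≢ z 0ℤ) (agree : AgreeFrom s z 1ℤ) where

  private
    sₜ zₜ : ℕ → Config
    sₜ t = iterate F t s
    zₜ t = iterate F t z

  front : ∀ t → sₜ t (+ t) ≢ zₜ t (+ t) × AgreeFrom (sₜ t) (zₜ t) (+ t + 1ℤ)
  front zero    = s₀≢z₀ , agree
  front (suc t) =
    subst (λ q → sₜ (suc t) q ≢ zₜ (suc t) q × AgreeFrom (sₜ (suc t)) (zₜ (suc t)) (q + 1ℤ)) t+1≡suc[t]
      (frontAdvances (Stream-iterate stream t) differ agreeₜ , lightCone-from 44 agreeₜ)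
    where
    differ : sₜ t (+ t) ≢ zₜ t (+ t)
    differ = proj₁ (front t)
    agreeₜ : AgreeFrom (sₜ t) (zₜ t) (+ t + 1ℤ)
    agreeₜ = proj₂ (front t)
    t+1≡suc[t] : + t + 1ℤ ≡ + suc t
    t+1≡suc[t] = cong +_ (ℕ.+-comm t 1)

  wallWithin2 : ∃ λ p → p ℤ.≤ + 2 × Wall (zₜ 2) p
  wallWithin2 = persist (wallForms (stream 1ℤ) z (¬-not (s₀≢z₀ ∘ sym)) (same 0) (same 1)
                          (trans (same 2) (streamTriple-period (stream 1ℤ) (stream (+ 2))))
                          (trans (same 3) (streamTriple-period (stream (+ 2)) (stream (+ 3))))
                          (trans (same 4) (streamTriple-period (stream (+ 3)) (stream (+ 4)))))
    where
    same : ∀ n → z (+ suc n) ≡ s (+ suc n)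
    same n = sym (agree (ℤ.+≤+ (s≤s z≤n)))
    persist : Wall z 0ℤ ⊎ Wall (F z) 1ℤ ⊎ Wall (F (F z)) (+ 2) → ∃ λ p → p ℤ.≤ + 2 × Wall (zₜ 2) p
    persist (inj₁ w)        = 0ℤ , ℤ.+≤+ z≤n , Wall-persists {z} {s = 0} {t = 2} w (ℕ.≤⇒≤′ z≤n)
    persist (inj₂ (inj₁ w)) = 1ℤ , ℤ.+≤+ (s≤s z≤n) ,
                              Wall-persists {z} {s = 1} {t = 2} w (ℕ.≤⇒≤′ (s≤s z≤n))
    persist (inj₂ (inj₂ w)) = + 2 , ≤-refl , w

  differenceNearWall : ∀ {t} → 2 ≤′ t → ∃ λ x → x ℤ.≤ + 3 × sₜ t x ≢ zₜ t x
  differenceNearWall {t} 2≤′t with wallWithin2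
  ... | p , p≤2 , w₂ with sₜ t p ≟ᴮ zₜ t p | sₜ t (p + 1ℤ) ≟ᴮ zₜ t (p + 1ℤ)
  ...   | no differ | _        = p , ≤-trans p≤2 (ℤ.+≤+ (ℕ.n≤1+n 2)) , differ
  ...   | yes _     | no differ = p + 1ℤ , ℤ.+-monoˡ-≤ 1ℤ p≤2 , differ
  ...   | yes same₀ | yes same₁ =
    contradiction (trans same₀ (left wₜ) , trans same₁ (right wₜ))
                  (streamTriple-¬00 (Stream-iterate stream t p))
    where
    wₜ : Wall (zₜ t) p
    wₜ = Wall-persists w₂ 2≤′t

rightmostDifference⇒unbounded : ∀ {y z R} → Stream y → y R ≢ z R → AgreeFrom y z (R + 1ℤ) →
                                ¬ BoundedDifference F y z
-- At time T = 3 + w the front sits at R + T, while a difference next to the wall sits at most at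
-- R + 3: no window of width w holds both.
rightmostDifference⇒unbounded {y} {z} {R} stream yR≢zR agree (w , bounded) =
  spread (proj₂ (bounded T))
  where
  open RightmostDifference (Stream-shift R stream)
         (subst (λ i → y i ≢ z i) (sym (+-identityʳ R)) yR≢zR)
         (λ 1≤i → agree (ℤ.+-monoʳ-≤ R 1≤i))
  T : ℕ
  T = 3 ℕ.+ w
  unshift : ∀ {i} → iterate F T (shift R y) i ≢ iterate F T (shift R z) i →
            iterate F T y (R + i) ≢ iterate F T z (R + i)
  unshift {i} differ eq =
    differ (trans (iterate-shift 44 R y T i) (trans eq (sym (iterate-shift 44 R z T i))))
  spread : ∀ {a} → ¬ (∀ i → iterate F T y i ≢ iterate F T z i → (a ℤ.≤ i) × (i ℤ.< a + + w))
  spread {a} window with differenceNearWall {T} (ℕ.≤⇒≤′ (s≤s (s≤s z≤n)))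
  ... | x , x≤3 , near = ℤ.≤⇒≯ a+w≤R+T (proj₂ (window (R + + T) (unshift (proj₁ (front T)))))
    where
    a+w≤R+T : a + + w ℤ.≤ R + + T
    a+w≤R+T = begin
      a + + w          ≤⟨ ℤ.+-monoˡ-≤ (+ w) (proj₁ (window (R + x) (unshift near))) ⟩
      R + x + + w      ≤⟨ ℤ.+-monoˡ-≤ (+ w) (ℤ.+-monoʳ-≤ R x≤3) ⟩
      R + + 3 + + w    ≡⟨ +-assoc R (+ 3) (+ w) ⟩
      R + + T          ∎
      where open ℤ.≤-Reasoning

-- Patches and protocols

lastCounterexample : ∀ {Q : ℕ → Set} → Decidable Q → ∀ n → (∀ {j} → n ℕ.≤ j → Q j) →
                     (∀ j → Q j) ⊎ ∃ λ r → ¬ Q r × (∀ {j} → r ℕ.< j → Q j)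
lastCounterexample Q? zero    above = inj₁ (λ j → above z≤n)
lastCounterexample {Q} Q? (suc n) above with Q? n
... | no ¬Qn = inj₂ (n , ¬Qn , above)
... | yes Qn = lastCounterexample Q? n above′
  where
  above′ : ∀ {j} → n ℕ.≤ j → Q j
  above′ n≤j with ℕ.m≤n⇒m<n∨m≡n n≤j
  ... | inj₁ n<j  = above n<j
  ... | inj₂ refl = Qn

Matches : Config → ℕ → ∀ {n} → Vec Bool n → Set
Matches y o v = ∀ j → lookup v j ≡ y (+ (o ℕ.+ toℕ j))

matches? : ∀ y o {n} → Decidable (Matches y o {n})
matches? y o v = all? (λ j → lookup v j ≟ᴮ y (+ (o ℕ.+ toℕ j)))

Matches-++ : ∀ y o {i m} (x : Vec Bool i) (x′ : Vec Bool m) →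
             Matches y o (x ++ x′) ⇔ (Matches y o x × Matches y (o ℕ.+ i) x′)
Matches-++ y o {i} {m} x x′ = mk⇔ split join
  where
  split : Matches y o (x ++ x′) → Matches y o x × Matches y (o ℕ.+ i) x′
  split match =
    (λ j → trans (sym (lookup-++ˡ x x′ j))
             (trans (match (j ↑ˡ m)) (cong (λ l → y (+ (o ℕ.+ l))) (toℕ-↑ˡ j m)))) ,
    (λ j → trans (sym (lookup-++ʳ x x′ j))
             (trans (match (i ↑ʳ j)) (cong (λ l → y (+ l))
               (trans (cong (o ℕ.+_) (toℕ-↑ʳ i j)) (sym (ℕ.+-assoc o i (toℕ j)))))))
  join : Matches y o x × Matches y (o ℕ.+ i) x′ → Matches y o (x ++ x′)
  join (match , match′) j with splitAt i j in eq
  ... | inj₁ l = subst (λ j → lookup (x ++ x′) j ≡ y (+ (o ℕ.+ toℕ j))) (splitAt⁻¹-↑ˡ eq)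
      (trans (lookup-++ˡ x x′ l) (trans (match l) (cong (λ l′ → y (+ (o ℕ.+ l′))) (sym (toℕ-↑ˡ l m)))))
  ... | inj₂ r = subst (λ j → lookup (x ++ x′) j ≡ y (+ (o ℕ.+ toℕ j))) (splitAt⁻¹-↑ʳ eq)
      (trans (lookup-++ʳ x x′ r) (trans (match′ r) (cong (λ l′ → y (+ l′))
        (trans (ℕ.+-assoc o i (toℕ r)) (cong (o ℕ.+_) (sym (toℕ-↑ʳ i r)))))))

module _ {k : ℕ} (u : Vec Bool (suc k)) where

  private
    P₀ P₂ : Config
    P₀ = periodic u
    P₂ = iterate F 2 P₀

  patch-below : ∀ {n} (v : Vec Bool n) → AgreeBelow P₀ (patch u v) -1ℤ
  patch-below v { -[1+ j ]} _ = refl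

  patch-from : ∀ {n} (v : Vec Bool n) → AgreeFrom P₀ (patch u v) (+ n)
  patch-from {n} v {+ j} (ℤ.+≤+ n≤j) with j ℕ.<? n
  ... | yes j<n = contradiction j<n (ℕ.≤⇒≯ n≤j)
  ... | no  _   = refl

  patch-lookup : ∀ {n} (v : Vec Bool n) j → patch u v (+ toℕ j) ≡ lookup v j
  patch-lookup {n} v j with toℕ j ℕ.<? n
  ... | yes j<n = cong (lookup v) (fromℕ<-toℕ j j<n)
  ... | no  j≮n = contradiction (toℕ<n j) j≮n

  Matches⇒patch≗ : ∀ {n} (v : Vec Bool n) → Matches P₀ 0 v → P₀ ≗ patch u v
  Matches⇒patch≗ {n} v match (+ j) with j ℕ.<? n
  ... | yes j<n = sym (trans (match (fromℕ< j<n)) (cong (P₀ ∘ +_) (toℕ-fromℕ< j<n)))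
  ... | no  _   = refl
  Matches⇒patch≗ v match -[1+ j ] = refl

  SInv⇔Matches : Stream P₀ → ∀ {n} (v : Vec Bool n) → SInv F u n v ⇔ Matches P₀ 0 v
  SInv⇔Matches stream {n} v = mk⇔ SInv⇒Matches (≗⇒BoundedDifference 44 ∘ Matches⇒patch≗ v)
    where
    SInv⇒Matches : SInv F u n v → Matches P₀ 0 v
    SInv⇒Matches bounded
      with lastCounterexample (λ j → P₀ (+ j) ≟ᴮ patch u v (+ j)) n (λ n≤j → patch-from v (ℤ.+≤+ n≤j))
    ... | inj₁ same = λ j → trans (sym (patch-lookup v j)) (sym (same (toℕ j)))
    ... | inj₂ (r , differ , above) =
      contradiction bounded (rightmostDifference⇒unbounded {R = + r} stream differ agree)
      where
      agree : AgreeFrom P₀ (patch u v) (+ r + 1ℤ)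
      agree {+ j} (ℤ.+≤+ r+1≤j) = above (subst (ℕ._≤ j) (ℕ.+-comm r 1) r+1≤j)

  noWallAtResidues⇒Stream : (∀ (j : Fin (suc k)) → ¬ Wall P₂ (+ toℕ j)) → Stream P₀
  noWallAtResidues⇒Stream noWall i =
    StreamTriple-cong refl (cong P₀ (+-identityʳ i)) refl
      (noWalls⇒streamTriple (shift i P₀) (noWall′ _) (noWall′ _) (noWall′ _))
    where
    noWallAnywhere : ∀ j → ¬ Wall P₂ j
    noWallAnywhere j w = noWall (fromℕ< (n%ℕd<d j (suc k)))
      (subst (Wall P₂ ∘ +_) (sym (toℕ-fromℕ< (n%ℕd<d j (suc k))))
        (Wall-residue (iterate-Periodic 44 {+ suc k} {P₀} (periodic-isPeriodic u) 2) w))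
    noWall′ : ∀ p → ¬ Wall (F (F (shift i P₀))) p
    noWall′ p = noWallAnywhere (i + p) ∘ Wall-shift {i} ∘ Wall-≗ (iterate-shift 44 i P₀ 2)

  wallOrStream : (∃ λ i₀ → Wall P₂ (+ i₀)) ⊎ Stream P₀
  wallOrStream with any? (λ (j : Fin (suc k)) → wall? P₂ (+ toℕ j))
  ... | yes (j , w) = inj₁ (toℕ j , w)
  ... | no  ¬w      = inj₂ (noWallAtResidues⇒Stream (λ j w → ¬w (j , w)))

DLe-const : ∀ {X Y} {P : X → Y → Set} → (∀ x y → P x y) → ∀ c → DLe P c
DLe-const holds c = leaf true , (λ x y → mk⇔ (λ _ → holds x y) (λ _ → refl)) , z≤n

DLe-× : ∀ {X Y} {P : X → Y → Set} {A : X → Set} {B : Y → Set} →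
        Decidable A → Decidable B → (∀ x y → P x y ⇔ (A x × B y)) → DLe P 2
DLe-× {X} {Y} {P} A? B? P⇔A×B = protocol , computes , ℕ.≤-refl
  where
  protocol : Protocol X Y Bool
  protocol = alice (λ x → isYes (A? x)) (leaf false) (bob (λ y → isYes (B? y)) (leaf false) (leaf true))
  computes : Computes protocol P
  computes x y with A? x | B? y
  ... | yes a | yes b = mk⇔ (λ _ → Equivalence.from (P⇔A×B x y) (a , b)) (λ _ → refl)
  ... | yes _ | no ¬b = mk⇔ (λ ()) (⊥-elim ∘ ¬b ∘ proj₂ ∘ Equivalence.to (P⇔A×B x y))
  ... | no ¬a | _     = mk⇔ (λ ()) (⊥-elim ∘ ¬a ∘ proj₁ ∘ Equivalence.to (P⇔A×B x y))

DLeSplit-intro : ∀ {c} (P : ∀ n → Vec Bool n → Set) →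
                 (∀ i m → DLe (λ (x : Vec Bool i) (x′ : Vec Bool m) → P (i ℕ.+ m) (x ++ x′)) c) →
                 ∀ n → DLeSplit (P n) c
DLeSplit-intro P protocols n i m refl = protocols i m

proposition14 : ∀ (k : ℕ) (u : Vec Bool (suc k)) →
    ∃₂ λ (c N : ℕ) → ∀ (n : ℕ) → N ≤ n → DLeSplit (SInv (ECA 44) u n) c
proposition14 k u = 2 , 0 , λ n _ → DLeSplit-intro (SInv F u) protocols n
  where
  protocols : ∀ i m → DLe (λ (x : Vec Bool i) (x′ : Vec Bool m) → SInv F u (i ℕ.+ m) (x ++ x′)) 2
  protocols i m with wallOrStream u
  ... | inj₁ (_ , w) = DLe-const (λ x x′ → wall⇒BoundedDifference (periodic-isPeriodic u)
                                   (patch-below u (x ++ x′)) (patch-from u (x ++ x′)) w) 2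
  ... | inj₂ stream = DLe-× (matches? (periodic u) 0) (matches? (periodic u) i)
                             (λ x x′ → Matches-++ (periodic u) 0 x x′ ⇔-∘ SInv⇔Matches u stream (x ++ x′))
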